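{- Let $G$ be a connected strongly regular graph with parameters $(n,k,a,c)$ which is neither the complete graph $K_n$ nor the pentagon $C_5$. Then $a-c \leq \frac{k-5}{2}$.
   Context: A strongly regular graph with parameters $(n,k,a,c)$ is a $k$-regular simple graph on $n$ vertices such that any two adjacent vertices have exactly $a$ common neighbours and any two distinct non-adjacent vertices have exactly $c$ common neighbours. Since $G$ is connected and not complete, $c\ge 1$. -}

module Defs where

open import Data.Nat using (ℕ; zero; suc; _≡ᵇ_; _%_)
open import Data.Bool using (Bool; true; false; _∧_; _∨_; if_then_else_)
open import Data.Bool.Properties using (∨-comm)
open import Data.Fin using (Fin; toℕ; zero; suc)
open import Data.List using (List; map; allFin)
open import Data.Nat.ListAction using (sum)
open import Data.Product using (Σ; _×_)
open import Function.Bundles using (Bijection; _⤖_)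
open import Relation.Binary.PropositionalEquality using (_≡_; _≢_; refl)
open import Relation.Nullary using (¬_)

record Graph (n : ℕ) : Set where
  field
    adj    : Fin n → Fin n → Bool
    sym    : ∀ u v → adj u v ≡ adj v u
    irrefl : ∀ v → adj v v ≡ false
open Graph public

module _ {n : ℕ} (G : Graph n) where

  countV : (Fin n → Bool) → ℕ
  countV p = sum (map (λ w → if p w then 1 else 0) (allFin n))

  degree : Fin n → ℕ
  degree v = countV (λ w → adj G v w)

  commonNbrs : Fin n → Fin n → ℕ
  commonNbrs u v = countV (λ w → adj G u w ∧ adj G v w)

  data Walk : Fin n → Fin n → Set where
    nil  : ∀ {v} → Walk v v
    cons : ∀ {u v w} → adj G u v ≡ true → Walk v w → Walk u w

  Connected : Set
  Connected = ∀ u v → Walk u v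

  IsComplete : Set
  IsComplete = ∀ u v → u ≢ v → adj G u v ≡ true

  IsSRG : ℕ → ℕ → ℕ → Set
  IsSRG k a c =
      (∀ v → degree v ≡ k)
    × (∀ u v → adj G u v ≡ true → commonNbrs u v ≡ a)
    × (∀ u v → u ≢ v → adj G u v ≡ false → commonNbrs u v ≡ c)

Isomorphic : {n m : ℕ} → Graph n → Graph m → Set
Isomorphic {n} {m} G H =
  Σ (Fin n ⤖ Fin m) λ f →
    ∀ u v → adj G u v ≡ adj H (Bijection.to f u) (Bijection.to f v)

c5adj : Fin 5 → Fin 5 → Bool
c5adj i j = (toℕ j ≡ᵇ (suc (toℕ i) % 5)) ∨ (toℕ i ≡ᵇ (suc (toℕ j) % 5))

pentagon : Graph 5
pentagon = record
  { adj = c5adj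
  ; sym = λ u v → ∨-comm (toℕ v ≡ᵇ (suc (toℕ u) % 5)) (toℕ u ≡ᵇ (suc (toℕ v) % 5))
  ; irrefl = irr
  }
  where
  irr : ∀ v → c5adj v v ≡ false
  irr zero = refl
  irr (suc zero) = refl
  irr (suc (suc zero)) = refl
  irr (suc (suc (suc zero))) = refl
  irr (suc (suc (suc (suc zero)))) = refl

module Submission where

-- We show a - c ≤ (k - 5)/2, i.e.
-- 2a + 5 ≤ k + 2c, by elementary counting of neighbourhoods.
--
-- Since G is connected and not complete it contains a cherry: an induced
-- path u ~ v ~ w with u ≁ w.  Counting N(v) around a cherry gives
-- 2a + 3 ≤ k + c and c ≥ 1, which settles c ≥ 2.  For c = 1 two
-- non-adjacent vertices have a unique common neighbour.  If moreover a ≥ 1,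
-- a short chase around the cherry produces an induced claw K₁,₃, and the
-- three disjoint blocks {ℓ} ∪ (N(ℓ) ∩ N(z)) at its leaves give k ≥ 3(a + 1).
-- If a = 0, then k ≥ 2, and k = 2 forces G to be the pentagon.

open import Defs renaming (sym to adj-sym; irrefl to adj-irrefl)
open import Data.Nat using (ℕ; zero; suc; _+_; _*_; _≤_; _<_; z≤n; s≤s)
open import Data.Nat.Properties hiding (_≟_)
open import Data.Nat.Properties using () renaming (_≟_ to _≟ℕ_)
open import Data.Bool using (Bool; true; false; _∧_; _∨_; not; if_then_else_)
open import Data.Bool.Properties using (∨-zeroʳ; ∧-identityʳ)
import Data.Bool.Properties as Bool
open import Data.Fin using (Fin; zero; suc; _≟_)
open import Data.Fin.Properties using (¬∀⟶∃¬; all?)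
open import Data.List using (map; tabulate)
open import Data.Nat.ListAction using (sum)
open import Data.Product using (∃; _×_; _,_; proj₁; proj₂)
import Data.Product as Σ
open import Data.Sum using (_⊎_; inj₁; inj₂; [_,_]′)
open import Data.Nat.Tactic.RingSolver using (solve-∀)
open import Data.Empty using (⊥; ⊥-elim)
open import Function using (id; _∘_; const; case_of_)
open import Function.Bundles using (mk⤖)
open import Relation.Nullary using (¬_; yes; no; does)
open import Relation.Nullary.Decidable using (¬?; _→-dec_; _⊎-dec_; from-yes)
open import Relation.Binary.PropositionalEquality

-- Membership and the set
-- operations are opaque: they are used only through the membership laws
-- below, which keeps unification on predicates syntactic.
Pred : ℕ → Set
Pred n = Fin n → Bool

module _ {n : ℕ} where

  infixr 6 _∩_
  infixr 5 _∪_
  infix 4 _∈_ _∉_ _⊆_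

  ∅ : Pred n
  ∅ _ = false

  opaque
    _∈_ _∉_ : Fin n → Pred n → Set
    x ∈ p = p x ≡ true
    x ∉ p = p x ≡ false

    _∪_ _∩_ : Pred n → Pred n → Pred n
    (p ∪ q) x = p x ∨ q x
    (p ∩ q) x = p x ∧ q x

    ∁ : Pred n → Pred n
    ∁ p x = not (p x)

    ｛_｝ : Fin n → Pred n
    ｛ x ｝ y = does (x ≟ y)

  _⊆_ : Pred n → Pred n → Set
  p ⊆ q = ∀ {x} → x ∈ p → x ∈ q

  opaque
    unfolding _∈_

    ∈-intro : {p : Pred n} {x : Fin n} → p x ≡ true → x ∈ p
    ∈-intro = id

    ∈-elim : {p : Pred n} {x : Fin n} → x ∈ p → p x ≡ true
    ∈-elim = id

    ∉-intro : {p : Pred n} {x : Fin n} → p x ≡ false → x ∉ p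
    ∉-intro = id

    ∉-elim : {p : Pred n} {x : Fin n} → x ∉ p → p x ≡ false
    ∉-elim = id

    ∈∉⇒≢ : {p : Pred n} {x y : Fin n} → x ∈ p → y ∉ p → x ≢ y
    ∈∉⇒≢ x∈p y∉p refl with () ← trans (sym x∈p) y∉p

    ∈∉-contra : {p : Pred n} {x : Fin n} → x ∈ p → x ∉ p → ⊥
    ∈∉-contra {p} x∈p x∉p = ∈∉⇒≢ {p = p} x∈p x∉p refl

    ¬∈⇒∉ : {p : Pred n} {x : Fin n} → ¬ x ∈ p → x ∉ p
    ¬∈⇒∉ {p} {x} x∉p with p x
    ... | true  = ⊥-elim (x∉p refl)
    ... | false = refl

module _ {n : ℕ} {p q : Pred n} {x : Fin n} where
  opaque
    unfolding _∈_

    ∩-intro : x ∈ p → x ∈ q → x ∈ p ∩ q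
    ∩-intro px qx rewrite px = qx

    ∩-elimˡ : x ∈ p ∩ q → x ∈ p
    ∩-elimˡ pqx with p x
    ... | true = refl

    ∩-elimʳ : x ∈ p ∩ q → x ∈ q
    ∩-elimʳ pqx with p x
    ... | true = pqx

    ∩-∉ʳ : x ∈ p → x ∉ p ∩ q → x ∉ q
    ∩-∉ʳ px pqx rewrite px = pqx

    ∪-introˡ : x ∈ p → x ∈ p ∪ q
    ∪-introˡ px rewrite px = refl

    ∪-introʳ : x ∈ q → x ∈ p ∪ q
    ∪-introʳ qx rewrite qx = ∨-zeroʳ (p x)

    ∪-elim : x ∈ p ∪ q → x ∈ p ⊎ x ∈ q
    ∪-elim pqx with p x
    ... | true  = inj₁ refl
    ... | false = inj₂ pqx

    ∪-∉ : x ∉ p ∪ q → x ∉ p × x ∉ q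
    ∪-∉ pqx with p x
    ... | false = refl , pqx

module _ {n : ℕ} {p : Pred n} {x : Fin n} where
  opaque
    unfolding _∈_

    ∁-intro : x ∉ p → x ∈ ∁ p
    ∁-intro px rewrite px = refl

    ∁-∉ : x ∈ ∁ p → x ∉ p
    ∁-∉ px with p x
    ... | false = refl

module _ {n : ℕ} where
  opaque
    unfolding _∈_

    ∈-｛｝ : (x : Fin n) → x ∈ ｛ x ｝
    ∈-｛｝ x with x ≟ x
    ... | yes _ = refl
    ... | no x≢x = ⊥-elim (x≢x refl)

    ∈-｛｝⁻ : {x y : Fin n} → y ∈ ｛ x ｝ → x ≡ y
    ∈-｛｝⁻ {x} {y} y∈x with x ≟ y
    ... | yes x≡y = x≡y

    ∉-｛｝ : {x y : Fin n} → x ≢ y → y ∉ ｛ x ｝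
    ∉-｛｝ {x} {y} x≢y with x ≟ y
    ... | yes x≡y = ⊥-elim (x≢y x≡y)
    ... | no _ = refl

ind : Bool → ℕ
ind b = if b then 1 else 0

count : ∀ {n} → Pred n → ℕ
count {zero}  p = 0
count {suc n} p = ind (p zero) + count (λ i → p (suc i))

countV≡count : ∀ {n} (G : Graph n) (p : Pred n) → countV G p ≡ count p
countV≡count {n} G p = sum-tabulate id
  where
  sum-tabulate : ∀ {m} (f : Fin m → Fin n) →
    sum (map (λ w → ind (p w)) (tabulate f)) ≡ count (λ i → p (f i))
  sum-tabulate {zero}  f = refl
  sum-tabulate {suc m} f = cong (ind (p (f zero)) +_) (sum-tabulate (λ i → f (suc i)))

opaque
  unfolding _∈_

  count-cong : ∀ {n} {p q : Pred n} → (∀ x → p x ≡ q x) → count p ≡ count q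
  count-cong {zero}  p≗q = refl
  count-cong {suc n} p≗q = cong₂ _+_ (cong ind (p≗q zero)) (count-cong (λ x → p≗q (suc x)))

  count-mono : ∀ {n} {p q : Pred n} → p ⊆ q → count p ≤ count q
  count-mono {zero} p⊆q = z≤n
  count-mono {suc n} {p} {q} p⊆q with p zero in p₀ | q zero in q₀
  ... | true  | true  = s≤s (count-mono (λ {x} → p⊆q {suc x}))
  ... | true  | false with () ← trans (sym (p⊆q p₀)) q₀
  ... | false | true  = m≤n⇒m≤1+n (count-mono (λ {x} → p⊆q {suc x}))
  ... | false | false = count-mono (λ {x} → p⊆q {suc x})

  count-∅ : ∀ {n} (p : Pred n) → (∀ x → x ∉ p) → count p ≡ 0
  count-∅ {zero}  p p-empty = refl
  count-∅ {suc n} p p-empty rewrite p-empty zero = count-∅ _ (λ x → p-empty (suc x))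

  count-excess : ∀ {n} (p q : Pred n) → count q < count p → ∃ λ x → x ∈ p × x ∉ q
  count-excess {suc n} p q q<p with p zero in p₀ | q zero in q₀
  ... | true  | false = zero , p₀ , q₀
  ... | true  | true  = Σ.map suc id (count-excess _ _ (≤-pred q<p))
  ... | false | true  = Σ.map suc id (count-excess _ _ (<⇒≤ q<p))
  ... | false | false = Σ.map suc id (count-excess _ _ q<p)

opaque
  unfolding _∩_

  count-∪ : ∀ {n} (p q : Pred n) → count (p ∪ q) + count (p ∩ q) ≡ count p + count q
  count-∪ {zero}  p q = refl
  count-∪ {suc n} p q with p zero | q zero | count-∪ (λ x → p (suc x)) (λ x → q (suc x))
  ... | true  | true  | ih = cong suc (trans (+-suc _ _) (trans (cong suc ih) (sym (+-suc _ _))))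
  ... | true  | false | ih = cong suc ih
  ... | false | true  | ih = trans (cong suc ih) (sym (+-suc _ _))
  ... | false | false | ih = ih

  count-remove : ∀ {n} (p : Pred n) {x : Fin n} → x ∈ p → count p ≡ suc (count (p ∩ ∁ ｛ x ｝))
  count-remove {suc n} p {zero} p₀ rewrite p₀ =
    cong suc (count-cong (λ x → sym (∧-identityʳ (p (suc x)))))
  count-remove {suc n} p {suc x} px rewrite ∧-identityʳ (p zero) =
    trans (cong (ind (p zero) +_) (count-remove (λ y → p (suc y)) px))
      (+-suc (ind (p zero)) (count ((λ y → p (suc y)) ∩ ∁ ｛ x ｝)))

module _ {n : ℕ} where

  count-witness : (p : Pred n) → 0 < count p → ∃ λ x → x ∈ p
  count-witness p 0<p =
    Σ.map id proj₁ (count-excess p ∅ (subst (_< count p) (sym (count-∅ {n} ∅ (λ _ → ∉-intro refl))) 0<p))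

  ∈-∖ : {p : Pred n} {x y : Fin n} → x ≢ y → y ∈ p → y ∈ p ∩ ∁ ｛ x ｝
  ∈-∖ x≢y y∈p = ∩-intro y∈p (∁-intro (∉-｛｝ x≢y))

  count-｛｝ : (x : Fin n) → count ｛ x ｝ ≡ 1
  count-｛｝ x = trans (count-remove ｛ x ｝ (∈-｛｝ x)) (cong suc (count-∅ (｛ x ｝ ∩ ∁ ｛ x ｝) empty))
    where
    empty : ∀ y → y ∉ ｛ x ｝ ∩ ∁ ｛ x ｝
    empty y = ¬∈⇒∉ λ y∈ → ∈∉-contra (∩-elimˡ y∈) (∁-∉ (∩-elimʳ y∈))

  count-strict : {p q : Pred n} {x : Fin n} → p ⊆ q → x ∈ q → x ∉ p → count p < count q
  count-strict {p} {q} {x} p⊆q x∈q x∉p = begin-strict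
    count p                   <⟨ s≤s (count-mono {p = p} {q = q ∩ ∁ ｛ x ｝} p⊆q∖x) ⟩
    suc (count (q ∩ ∁ ｛ x ｝)) ≡⟨ sym (count-remove q x∈q) ⟩
    count q                   ∎
    where
    open ≤-Reasoning
    p⊆q∖x : p ⊆ q ∩ ∁ ｛ x ｝
    p⊆q∖x y∈p = ∈-∖ (∈∉⇒≢ {p = p} y∈p x∉p ∘ sym) (p⊆q y∈p)

  count-disjoint : (p q : Pred n) → (∀ x → x ∉ p ∩ q) → count (p ∪ q) ≡ count p + count q
  count-disjoint p q disjoint = trans (sym (+-identityʳ _))
    (trans (cong (count (p ∪ q) +_) (sym (count-∅ _ disjoint))) (count-∪ p q))

  count-subadditive : (p q : Pred n) → count (p ∪ q) ≤ count p + count q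
  count-subadditive p q = ≤-trans (m≤m+n _ _) (≤-reflexive (count-∪ p q))

  count≥1 : {p : Pred n} {x : Fin n} → x ∈ p → 1 ≤ count p
  count≥1 {p} x∈p rewrite count-remove p x∈p = s≤s z≤n

  count≥2 : {p : Pred n} {x y : Fin n} → x ≢ y → x ∈ p → y ∈ p → 2 ≤ count p
  count≥2 {p} x≢y x∈p y∈p rewrite count-remove p x∈p = s≤s (count≥1 (∈-∖ x≢y y∈p))

  count≥3 : {p : Pred n} {x y z : Fin n} → x ≢ y → x ≢ z → y ≢ z →
    x ∈ p → y ∈ p → z ∈ p → 3 ≤ count p
  count≥3 {p} x≢y x≢z y≢z x∈p y∈p z∈p rewrite count-remove p x∈p =
    s≤s (count≥2 y≢z (∈-∖ x≢y y∈p) (∈-∖ x≢z z∈p))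

pattern v₀ = zero
pattern v₁ = suc zero
pattern v₂ = suc (suc zero)
pattern v₃ = suc (suc (suc zero))
pattern v₄ = suc (suc (suc (suc zero)))

next prev : Fin 5 → Fin 5
next v₀ = v₁
next v₁ = v₂
next v₂ = v₃
next v₃ = v₄
next v₄ = v₀
prev v₀ = v₄
prev v₁ = v₀
prev v₂ = v₁
prev v₃ = v₂
prev v₄ = v₃

c5-position : ∀ i j → j ≡ i ⊎ j ≡ next i ⊎ i ≡ next j ⊎ j ≡ next (next i) ⊎ i ≡ next (next j)
c5-position = from-yes (all? λ i → all? λ j →
  (j ≟ i) ⊎-dec (j ≟ next i) ⊎-dec (i ≟ next j) ⊎-dec (j ≟ next (next i)) ⊎-dec (i ≟ next (next j)))

c5-next : ∀ i → c5adj i (next i) ≡ true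
c5-next = from-yes (all? λ i → c5adj i (next i) Bool.≟ true)

c5-prev : ∀ i → c5adj i (prev i) ≡ true
c5-prev = from-yes (all? λ i → c5adj i (prev i) Bool.≟ true)

c5-distance-two : ∀ i → c5adj i (next (next i)) ≡ false
c5-distance-two = from-yes (all? λ i → c5adj i (next (next i)) Bool.≟ false)

c5-prev≢next : ∀ i → prev i ≢ next i
c5-prev≢next = from-yes (all? λ i → ¬? (prev i ≟ next i))

c5-common : ∀ i j → c5adj j (prev i) ≡ true → c5adj j (next i) ≡ true → j ≡ i
c5-common = from-yes (all? λ i → all? λ j →
  (c5adj j (prev i) Bool.≟ true) →-dec ((c5adj j (next i) Bool.≟ true) →-dec (j ≟ i)))

module Graphs {n : ℕ} (G : Graph n) where

  N : Fin n → Pred n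
  N = adj G

  infix 4 _~_ _≁_
  _~_ _≁_ : Fin n → Fin n → Set
  u ~ v = v ∈ N u
  u ≁ v = v ∉ N u

  NonAdj : Fin n → Fin n → Set
  NonAdj u v = u ≢ v × u ≁ v

  ~-sym : ∀ {u v} → u ~ v → v ~ u
  ~-sym {u} {v} u~v = ∈-intro (trans (adj-sym G v u) (∈-elim u~v))

  ≁-sym : ∀ {u v} → u ≁ v → v ≁ u
  ≁-sym {u} {v} u≁v = ∉-intro (trans (adj-sym G v u) (∉-elim u≁v))

  ≁-refl : ∀ v → v ≁ v
  ≁-refl v = ∉-intro (adj-irrefl G v)

  ~⇒≢ : ∀ {u v} → u ~ v → u ≢ v
  ~⇒≢ {u} u~v refl = ∈∉-contra u~v (≁-refl u)

  ~-or-≁ : ∀ u v → u ~ v ⊎ u ≁ v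
  ~-or-≁ u v with adj G u v in u?v
  ... | true  = inj₁ (∈-intro u?v)
  ... | false = inj₂ (∉-intro u?v)

  record Cherry : Set where
    field
      {u v w} : Fin n
      u~v     : u ~ v
      v~w     : v ~ w
      u-w     : NonAdj u w

  record Claw (z : Fin n) : Set where
    field
      {ℓ₁ ℓ₂ ℓ₃}  : Fin n
      z~ℓ₁       : z ~ ℓ₁
      z~ℓ₂       : z ~ ℓ₂
      z~ℓ₃       : z ~ ℓ₃
      ℓ₁-ℓ₂      : NonAdj ℓ₁ ℓ₂
      ℓ₁-ℓ₃      : NonAdj ℓ₁ ℓ₃
      ℓ₂-ℓ₃      : NonAdj ℓ₂ ℓ₃

  nonadjacent-pair : ¬ IsComplete G → ∃ λ x → ∃ λ y → NonAdj x y
  nonadjacent-pair incomplete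
    with ¬∀⟶∃¬ n _ (λ x → all? λ y → ¬? (x ≟ y) →-dec (adj G x y Bool.≟ true)) incomplete
  ... | x , ¬x-universal
    with ¬∀⟶∃¬ n _ (λ y → ¬? (x ≟ y) →-dec (adj G x y Bool.≟ true)) ¬x-universal
  ... | y , ¬x~y = x , y , x≢y , ∉-intro (Bool.¬-not (¬x~y ∘ const))
    where
    x≢y : x ≢ y
    x≢y refl = ¬x~y (λ x≢x → ⊥-elim (x≢x refl))

  cherry-on-walk : ∀ {x y} → Walk G x y → NonAdj x y → Cherry
  cherry-on-walk nil (x≢x , _) = ⊥-elim (x≢x refl)
  cherry-on-walk {x} {y} (cons {v = z} x~z rest) x-y with z ≟ y
  ... | yes refl = ⊥-elim (∈∉-contra (∈-intro x~z) (proj₂ x-y))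
  ... | no z≢y with adj G z y in z~y
  ... |   true  = record { u~v = ∈-intro x~z ; v~w = ∈-intro z~y ; u-w = x-y }
  ... |   false = cherry-on-walk rest (z≢y , ∉-intro z~y)

  cherry-exists : Connected G → ¬ IsComplete G → Cherry
  cherry-exists connected incomplete with nonadjacent-pair incomplete
  ... | x , y , x-y = cherry-on-walk (connected x y) x-y

module SRG {n : ℕ} (G : Graph n) (k a c : ℕ) (srg : IsSRG G k a c) where

  open Graphs G public

  common : Fin n → Fin n → Pred n
  common u v = N u ∩ N v

  opaque
    unfolding _∩_

    common≡commonNbrs : ∀ u v → count (common u v) ≡ commonNbrs G u v
    common≡commonNbrs u v = sym (countV≡count G _)

  degree-law : ∀ v → count (N v) ≡ k
  degree-law v = trans (sym (countV≡count G (N v))) (proj₁ srg v)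

  λ-law : ∀ {u v} → u ~ v → count (common u v) ≡ a
  λ-law {u} {v} u~v = trans (common≡commonNbrs u v) (proj₁ (proj₂ srg) u v (∈-elim u~v))

  μ-law : ∀ {u v} → NonAdj u v → count (common u v) ≡ c
  μ-law {u} {v} (u≢v , u≁v) = trans (common≡commonNbrs u v) (proj₂ (proj₂ srg) u v u≢v (∉-elim u≁v))

  ∈-common : ∀ {u v x} → u ~ x → v ~ x → x ∈ common u v
  ∈-common = ∩-intro

  -- The middle vertex v of a cherry u ~ v ~ w is adjacent to both ends and
  -- to the common neighbours of v with u and with w; ends and common
  -- neighbours are disjoint, and the vertices common to both families are
  -- common neighbours of u and w other than v, so there are fewer than c.
  cherry-bound : Cherry → 2 * a + 3 ≤ k + c
  cherry-bound record { u = u ; v = v ; w = w ; u~v = u~v ; v~w = v~w ; u-w = u-w } = begin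
    2 * a + 3                             ≡⟨ double+3 a ⟩
    2 + suc (a + a)                       ≡⟨ cong (λ m → 2 + suc m) (sym M+T) ⟩
    2 + suc (count M + count T)           ≤⟨ +-monoˡ-≤ _ E≥2 ⟩
    count E + suc (count M + count T)     ≡⟨ cong (count E +_) (sym (+-suc _ _)) ⟩
    count E + (count M + suc (count T))   ≡⟨ sym (+-assoc (count E) _ _) ⟩
    count E + count M + suc (count T)     ≡⟨ cong (_+ suc (count T)) (sym (count-disjoint E M E∩M-empty)) ⟩
    count (E ∪ M) + suc (count T)         ≤⟨ +-mono-≤ E∪M≤k T<c ⟩
    k + c                                 ∎
    where
    open ≤-Reasoning
    double+3 : ∀ a → 2 * a + 3 ≡ 2 + suc (a + a)
    double+3 = solve-∀

    E M T : Pred n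
    E = ｛ u ｝ ∪ ｛ w ｝
    M = common u v ∪ common w v
    T = common u v ∩ common w v

    E≥2 : 2 ≤ count E
    E≥2 = count≥2 (proj₁ u-w) (∪-introˡ (∈-｛｝ u)) (∪-introʳ (∈-｛｝ w))

    M+T : count M + count T ≡ a + a
    M+T = trans (count-∪ (common u v) (common w v)) (cong₂ _+_ (λ-law u~v) (λ-law (~-sym v~w)))

    E∪M⊆Nv : E ∪ M ⊆ N v
    E∪M⊆Nv x∈ with ∪-elim x∈
    ... | inj₂ x∈M = [ ∩-elimʳ , ∩-elimʳ ]′ (∪-elim x∈M)
    ... | inj₁ x∈E with ∪-elim x∈E
    ... |   inj₁ x∈u = subst (v ~_) (∈-｛｝⁻ x∈u) (~-sym u~v)
    ... |   inj₂ x∈w = subst (v ~_) (∈-｛｝⁻ x∈w) v~w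

    E∪M≤k : count (E ∪ M) ≤ k
    E∪M≤k = ≤-trans (count-mono E∪M⊆Nv) (≤-reflexive (degree-law v))

    E-isolated : ∀ {x} → x ∈ E → u ≁ x × w ≁ x
    E-isolated x∈E with ∪-elim x∈E
    ... | inj₁ x∈u = subst (λ y → u ≁ y × w ≁ y) (∈-｛｝⁻ x∈u) (≁-refl u , ≁-sym (proj₂ u-w))
    ... | inj₂ x∈w = subst (λ y → u ≁ y × w ≁ y) (∈-｛｝⁻ x∈w) (proj₂ u-w , ≁-refl w)

    E∩M-empty : ∀ x → x ∉ E ∩ M
    E∩M-empty x = ¬∈⇒∉ λ x∈ → case ∪-elim (∩-elimʳ x∈) of λ where
      (inj₁ x∈uv) → ∈∉-contra (∩-elimˡ x∈uv) (proj₁ (E-isolated (∩-elimˡ x∈)))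
      (inj₂ x∈wv) → ∈∉-contra (∩-elimˡ x∈wv) (proj₂ (E-isolated (∩-elimˡ x∈)))

    T<c : count T < c
    T<c = ≤-trans (count-strict T⊆uw (∈-common u~v (~-sym v~w)) v∉T) (≤-reflexive (μ-law u-w))
      where
      T⊆uw : T ⊆ common u w
      T⊆uw x∈ = ∈-common (∩-elimˡ (∩-elimˡ x∈)) (∩-elimˡ (∩-elimʳ x∈))
      v∉T : v ∉ T
      v∉T = ¬∈⇒∉ λ v∈ → ∈∉-contra (∩-elimʳ (∩-elimˡ v∈)) (≁-refl v)

  -- the middle of a cherry is a common neighbour of its ends
  μ-positive : Cherry → 1 ≤ c
  μ-positive record { u~v = u~v ; v~w = v~w ; u-w = u-w } =
    ≤-trans (count≥1 (∈-common u~v (~-sym v~w))) (≤-reflexive (μ-law u-w))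

  far-neighbour : ∀ {v w} → v ~ w → a + 2 ≤ k → ∃ λ y → w ~ y × NonAdj v y
  far-neighbour {v} {w} v~w a+2≤k with count-excess (N w) (common w v ∪ ｛ v ｝) near<k
    where
    near<k : count (common w v ∪ ｛ v ｝) < count (N w)
    near<k = begin-strict
      count (common w v ∪ ｛ v ｝)          ≤⟨ count-subadditive (common w v) ｛ v ｝ ⟩
      count (common w v) + count ｛ v ｝    ≡⟨ cong₂ _+_ (λ-law (~-sym v~w)) (count-｛｝ v) ⟩
      a + 1                               <⟨ subst (_≤ k) (+-suc a 1) a+2≤k ⟩
      k                                   ≡⟨ sym (degree-law w) ⟩
      count (N w)                         ∎
      where open ≤-Reasoning
  ... | y , w~y , y∉near = y , w~y , ∈∉⇒≢ (∈-｛｝ v) y∉v , ∩-∉ʳ w~y y∉wv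
    where
    y∉wv = proj₁ (∪-∉ y∉near)
    y∉v  = proj₂ (∪-∉ y∉near)

  triangle-free : a ≡ 0 → ∀ {p q s} → p ~ q → p ~ s → q ~ s → ⊥
  triangle-free a≡0 p~q p~s q~s with ≤-trans (count≥1 (∈-common p~s q~s)) (≤-reflexive (trans (λ-law p~q) a≡0))
  ... | ()

  other-neighbour : k ≡ 2 → ∀ {p q} → p ~ q → ∃ λ t → p ~ t × t ≢ q
  other-neighbour k≡2 {p} {q} p~q with count-excess (N p) ｛ q ｝ one<two
    where
    one<two : count ｛ q ｝ < count (N p)
    one<two = subst₂ _<_ (sym (count-｛｝ q)) (sym (trans (degree-law p) k≡2)) (s≤s (s≤s z≤n))
  ... | t , p~t , t∉q = t , p~t , ∈∉⇒≢ (∈-｛｝ q) t∉q ∘ sym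

  only-two-neighbours : k ≡ 2 → ∀ {p q₁ q₂ t} → q₁ ≢ q₂ → p ~ q₁ → p ~ q₂ → p ~ t → t ≡ q₁ ⊎ t ≡ q₂
  only-two-neighbours k≡2 {p} {q₁} {q₂} {t} q₁≢q₂ p~q₁ p~q₂ p~t with t ≟ q₁ | t ≟ q₂
  ... | yes t≡q₁ | _         = inj₁ t≡q₁
  ... | no _     | yes t≡q₂  = inj₂ t≡q₂
  ... | no t≢q₁  | no t≢q₂
    with ≤-trans (count≥3 q₁≢q₂ (t≢q₁ ∘ sym) (t≢q₂ ∘ sym) p~q₁ p~q₂ p~t) (≤-reflexive (trans (degree-law p) k≡2))
  ... | s≤s (s≤s ())

  module UniqueCommonNeighbour (μ≡1 : c ≡ 1) where

    unique-common : ∀ {p q s t} → NonAdj p q → s ∈ common p q → t ∈ common p q → s ≡ t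
    unique-common {s = s} {t} p-q s∈ t∈ with s ≟ t
    ... | yes s≡t = s≡t
    ... | no s≢t with ≤-trans (count≥2 s≢t s∈ t∈) (≤-reflexive (trans (μ-law p-q) μ≡1))
    ... |   s≤s ()

    common-witness : ∀ {p q} → NonAdj p q → ∃ λ s → s ∈ common p q
    common-witness {p} {q} p-q =
      count-witness (common p q) (subst (0 <_) (sym (trans (μ-law p-q) μ≡1)) (s≤s z≤n))

    module Blocks (z : Fin n) where

      B : Fin n → Pred n
      B x = ｛ x ｝ ∪ common x z

      block-size : ∀ {x} → z ~ x → count (B x) ≡ suc a
      block-size {x} z~x = trans (count-disjoint ｛ x ｝ (common x z) x∉common)
        (cong₂ _+_ (count-｛｝ x) (λ-law (~-sym z~x)))
        where
        x∉common : ∀ y → y ∉ ｛ x ｝ ∩ common x z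
        x∉common y = ¬∈⇒∉ λ y∈ → ∈∉-contra (∩-elimˡ (∩-elimʳ y∈))
          (subst (x ≁_) (∈-｛｝⁻ (∩-elimˡ y∈)) (≁-refl x))

      B⊆Nz : ∀ {x} → z ~ x → B x ⊆ N z
      B⊆Nz z~x y∈ with ∪-elim y∈
      ... | inj₁ y∈x = subst (z ~_) (∈-｛｝⁻ y∈x) z~x
      ... | inj₂ y∈xz = ∩-elimʳ y∈xz

      blocks-disjoint : ∀ {x y} → z ~ x → z ~ y → NonAdj x y → ∀ s → s ∉ B x ∩ B y
      blocks-disjoint {x} {y} z~x z~y x-y s =
        ¬∈⇒∉ λ s∈ → clash (∪-elim (∩-elimˡ s∈)) (∪-elim (∩-elimʳ s∈))
        where
        clash : s ∈ ｛ x ｝ ⊎ s ∈ common x z → s ∈ ｛ y ｝ ⊎ s ∈ common y z → ⊥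
        clash (inj₁ s∈x) (inj₁ s∈y) = proj₁ x-y (trans (∈-｛｝⁻ s∈x) (sym (∈-｛｝⁻ s∈y)))
        clash (inj₁ s∈x) (inj₂ s∈yz) =
          ∈∉-contra (∩-elimˡ s∈yz) (subst (y ≁_) (∈-｛｝⁻ s∈x) (≁-sym (proj₂ x-y)))
        clash (inj₂ s∈xz) (inj₁ s∈y) =
          ∈∉-contra (∩-elimˡ s∈xz) (subst (x ≁_) (∈-｛｝⁻ s∈y) (proj₂ x-y))
        clash (inj₂ s∈xz) (inj₂ s∈yz) =
          ∈∉-contra (∩-elimʳ s∈xz) (subst (z ≁_) (sym s≡z) (≁-refl z))
          where
          -- s and z would be two common neighbours of x and y
          s≡z : s ≡ z
          s≡z = unique-common x-y (∈-common (∩-elimˡ s∈xz) (∩-elimˡ s∈yz))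
                                  (∈-common (~-sym z~x) (~-sym z~y))

    -- the three blocks of a claw fill at most N z
    claw-bound : ∀ {z} → Claw z → 3 * suc a ≤ k
    claw-bound {z} record { ℓ₁ = ℓ₁ ; ℓ₂ = ℓ₂ ; ℓ₃ = ℓ₃ ; z~ℓ₁ = z~ℓ₁ ; z~ℓ₂ = z~ℓ₂ ; z~ℓ₃ = z~ℓ₃
                          ; ℓ₁-ℓ₂ = ℓ₁-ℓ₂ ; ℓ₁-ℓ₃ = ℓ₁-ℓ₃ ; ℓ₂-ℓ₃ = ℓ₂-ℓ₃ } = begin
      3 * suc a                                    ≡⟨ cong (λ m → suc a + (suc a + m)) (+-identityʳ (suc a)) ⟩
      suc a + (suc a + suc a)                      ≡⟨ sym (cong₂ _+_ (block-size z~ℓ₁)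
                                                        (cong₂ _+_ (block-size z~ℓ₂) (block-size z~ℓ₃))) ⟩
      count (B ℓ₁) + (count (B ℓ₂) + count (B ℓ₃)) ≡⟨ cong (count (B ℓ₁) +_)
                                                        (sym (count-disjoint _ _ (blocks-disjoint z~ℓ₂ z~ℓ₃ ℓ₂-ℓ₃))) ⟩
      count (B ℓ₁) + count (B ℓ₂ ∪ B ℓ₃)           ≡⟨ sym (count-disjoint _ _ B₁∩B₂₃-empty) ⟩
      count (B ℓ₁ ∪ B ℓ₂ ∪ B ℓ₃)                   ≤⟨ count-mono B₁₂₃⊆Nz ⟩
      count (N z)                                  ≡⟨ degree-law z ⟩
      k                                            ∎
      where
      open ≤-Reasoning
      open Blocks z

      B₁∩B₂₃-empty : ∀ s → s ∉ B ℓ₁ ∩ (B ℓ₂ ∪ B ℓ₃)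
      B₁∩B₂₃-empty s = ¬∈⇒∉ λ s∈ → case ∪-elim (∩-elimʳ s∈) of λ where
        (inj₁ s∈B₂) → ∈∉-contra (∩-intro (∩-elimˡ s∈) s∈B₂) (blocks-disjoint z~ℓ₁ z~ℓ₂ ℓ₁-ℓ₂ s)
        (inj₂ s∈B₃) → ∈∉-contra (∩-intro (∩-elimˡ s∈) s∈B₃) (blocks-disjoint z~ℓ₁ z~ℓ₃ ℓ₁-ℓ₃ s)

      B₁₂₃⊆Nz : B ℓ₁ ∪ B ℓ₂ ∪ B ℓ₃ ⊆ N z
      B₁₂₃⊆Nz s∈ with ∪-elim s∈
      ... | inj₁ s∈B₁ = B⊆Nz z~ℓ₁ s∈B₁
      ... | inj₂ s∈B₂₃ = [ B⊆Nz z~ℓ₂ , B⊆Nz z~ℓ₃ ]′ (∪-elim s∈B₂₃)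

    -- Then y is the centre of a claw whose leaves are w and the common
    -- neighbours t, t′ of y with u and with u′.
    module FarClaw {u v w u′ y : Fin n} (u~v : u ~ v) (v~w : v ~ w) (u-w : NonAdj u w)
                   (u′∈uv : u′ ∈ common u v) (w~y : w ~ y) (v-y : NonAdj v y) where

      u~u′ : u ~ u′
      u~u′ = ∩-elimˡ u′∈uv

      v~u′ : v ~ u′
      v~u′ = ∩-elimʳ u′∈uv

      y≁v : y ≁ v
      y≁v = ≁-sym (proj₂ v-y)

      -- u′ lies off the common neighbourhood of u and w, whose only member is v
      u′-w : NonAdj u′ w
      u′-w = ∈∉⇒≢ u~u′ (proj₂ u-w) , ¬∈⇒∉ λ u′~w →
        ~⇒≢ v~u′ (unique-common u-w (∈-common u~v (~-sym v~w)) (∈-common u~u′ (~-sym u′~w)))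

      far-from : ∀ {x} → v ~ x → NonAdj x w → NonAdj y x
      far-from {x} v~x x-w = ∈∉⇒≢ v~x (proj₂ v-y) ∘ sym , ¬∈⇒∉ λ y~x →
        proj₁ v-y (unique-common x-w (∈-common (~-sym v~x) (~-sym v~w)) (∈-common (~-sym y~x) w~y))

      far-leaf : ∀ {x s} → v ~ x → NonAdj x w → s ∈ common y x → NonAdj w s
      far-leaf {x} {s} v~x x-w s∈yx = ∈∉⇒≢ (∩-elimʳ s∈yx) (proj₂ x-w) ∘ sym , ¬∈⇒∉ λ w~s →
        ∈∉⇒≢ (∩-elimˡ s∈yx) y≁v
          (sym (unique-common x-w (∈-common (~-sym v~x) (~-sym v~w)) (∈-common (∩-elimʳ s∈yx) w~s)))

      y-u : NonAdj y u
      y-u = far-from (~-sym u~v) u-w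

      y-u′ : NonAdj y u′
      y-u′ = far-from v~u′ u′-w

      t t′ : Fin n
      t  = proj₁ (common-witness y-u)
      t′ = proj₁ (common-witness y-u′)

      t∈yu : t ∈ common y u
      t∈yu = proj₂ (common-witness y-u)

      t′∈yu′ : t′ ∈ common y u′
      t′∈yu′ = proj₂ (common-witness y-u′)

      w-t : NonAdj w t
      w-t = far-leaf (~-sym u~v) u-w t∈yu

      w-t′ : NonAdj w t′
      w-t′ = far-leaf v~u′ u′-w t′∈yu′

      -- if t = t′, then t is adjacent to v (and equals w) or is a second
      -- common neighbour of the non-adjacent pair t, v besides u and u′
      t≢t′ : t ≢ t′
      t≢t′ t≡t′ with ~-or-≁ v t
      ... | inj₁ v~t = proj₁ w-t (unique-common v-y (∈-common v~w (~-sym w~y))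
                                                   (∈-common v~t (∩-elimˡ t∈yu)))
      ... | inj₂ v≁t = ~⇒≢ u~u′ (unique-common t-v (∈-common (~-sym (∩-elimʳ t∈yu)) (~-sym u~v))
                                                   (∈-common (~-sym u′~t) v~u′))
        where
        u′~t : u′ ~ t
        u′~t = subst (u′ ~_) (sym t≡t′) (∩-elimʳ t′∈yu′)
        t-v : NonAdj t v
        t-v = ∈∉⇒≢ (∩-elimˡ t∈yu) y≁v , ≁-sym v≁t

      -- if t ~ t′, then u′ and t are two common neighbours of u and t′
      t≁t′ : t ≁ t′
      t≁t′ = ¬∈⇒∉ λ t~t′ →
        ∈∉⇒≢ (∩-elimˡ t∈yu) (proj₂ y-u′)
          (sym (unique-common u-t′ (∈-common u~u′ (~-sym (∩-elimʳ t′∈yu′)))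
                                   (∈-common (∩-elimʳ t∈yu) (~-sym t~t′))))
        where
        u-t′ : NonAdj u t′
        u-t′ = ∈∉⇒≢ (∩-elimˡ t′∈yu′) (proj₂ y-u) ∘ sym , ¬∈⇒∉ λ u~t′ →
          t≢t′ (unique-common y-u t∈yu (∈-common (∩-elimˡ t′∈yu′) u~t′))

      claw : Claw y
      claw = record
        { z~ℓ₁ = ~-sym w~y ; z~ℓ₂ = ∩-elimˡ t∈yu ; z~ℓ₃ = ∩-elimˡ t′∈yu′
        ; ℓ₁-ℓ₂ = w-t ; ℓ₁-ℓ₃ = w-t′ ; ℓ₂-ℓ₃ = t≢t′ , t≁t′ }

    claw-exists : 1 ≤ a → a + 2 ≤ k → Cherry → ∃ Claw
    claw-exists 1≤a a+2≤k record { u = u ; v = v ; u~v = u~v ; v~w = v~w ; u-w = u-w }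
      with count-witness (common u v) (subst (1 ≤_) (sym (λ-law u~v)) 1≤a) | far-neighbour v~w a+2≤k
    ... | u′ , u′∈uv | y , w~y , v-y = y , FarClaw.claw u~v v~w u-w u′∈uv w~y v-y

    -- For a = 0 and k = 2 a cherry u ~ v ~ w closes up to a pentagon
    -- u ~ v ~ w ~ y ~ x ~ u, which by connectedness is the whole graph.
    module Pentagon (a≡0 : a ≡ 0) (k≡2 : k ≡ 2) (connected : Connected G)
                    {u v w : Fin n} (u~v : u ~ v) (v~w : v ~ w) (u-w : NonAdj u w) where

      x y : Fin n
      x = proj₁ (other-neighbour k≡2 u~v)
      y = proj₁ (other-neighbour k≡2 (~-sym v~w))

      u~x : u ~ x
      u~x = proj₁ (proj₂ (other-neighbour k≡2 u~v))

      w~y : w ~ y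
      w~y = proj₁ (proj₂ (other-neighbour k≡2 (~-sym v~w)))

      v≁x : v ≁ x
      v≁x = ¬∈⇒∉ (triangle-free a≡0 u~v u~x)

      v≁y : v ≁ y
      v≁y = ¬∈⇒∉ (triangle-free a≡0 (~-sym v~w) w~y)

      -- v is the common neighbour of u and w, so x (≠ v) is not adjacent to w
      x-w : NonAdj x w
      x-w = ∈∉⇒≢ u~x (proj₂ u-w) , ¬∈⇒∉ λ x~w →
        proj₂ (proj₂ (other-neighbour k≡2 u~v))
          (sym (unique-common u-w (∈-common u~v (~-sym v~w)) (∈-common u~x (~-sym x~w))))

      -- the common neighbour of x and w is a neighbour of w other than v, hence y
      x~y : x ~ y
      x~y with common-witness x-w
      ... | t , t∈xw with only-two-neighbours k≡2 v≢y (~-sym v~w) w~y (∩-elimʳ t∈xw)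
        where v≢y = proj₂ (proj₂ (other-neighbour k≡2 (~-sym v~w))) ∘ sym
      ... | inj₁ t≡v = ⊥-elim (∈∉-contra (subst (x ~_) t≡v (∩-elimˡ t∈xw)) (≁-sym v≁x))
      ... | inj₂ t≡y = subst (x ~_) t≡y (∩-elimˡ t∈xw)

      y≁u : y ≁ u
      y≁u = ¬∈⇒∉ (triangle-free a≡0 x~y (~-sym u~x))

      g : Fin 5 → Fin n
      g v₀ = u
      g v₁ = v
      g v₂ = w
      g v₃ = y
      g v₄ = x

      g-edge : ∀ i → g i ~ g (next i)
      g-edge v₀ = u~v
      g-edge v₁ = v~w
      g-edge v₂ = w~y
      g-edge v₃ = ~-sym x~y
      g-edge v₄ = ~-sym u~x

      g-diagonal : ∀ i → g i ≁ g (next (next i))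
      g-diagonal v₀ = proj₂ u-w
      g-diagonal v₁ = v≁y
      g-diagonal v₂ = ≁-sym (proj₂ x-w)
      g-diagonal v₃ = y≁u
      g-diagonal v₄ = ≁-sym v≁x

      g-adj : ∀ i j → adj G (g i) (g j) ≡ c5adj i j
      g-adj i j with c5-position i j
      ... | inj₁ refl = trans (adj-irrefl G (g i)) (sym (adj-irrefl pentagon i))
      ... | inj₂ (inj₁ refl) = trans (∈-elim (g-edge i)) (sym (c5-next i))
      ... | inj₂ (inj₂ (inj₁ refl)) =
        trans (∈-elim (~-sym (g-edge j))) (sym (trans (adj-sym pentagon (next j) j) (c5-next j)))
      ... | inj₂ (inj₂ (inj₂ (inj₁ refl))) = trans (∉-elim (g-diagonal i)) (sym (c5-distance-two i))
      ... | inj₂ (inj₂ (inj₂ (inj₂ refl))) =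
        trans (∉-elim (≁-sym (g-diagonal j))) (sym (trans (adj-sym pentagon (next (next j)) j) (c5-distance-two j)))

      -- g i is determined by its neighbours g (prev i) and g (next i)
      g-injective : ∀ {i j} → g i ≡ g j → i ≡ j
      g-injective {i} {j} gi≡gj = sym (c5-common i j (same (prev i) (c5-prev i)) (same (next i) (c5-next i)))
        where
        same : ∀ m → c5adj i m ≡ true → c5adj j m ≡ true
        same m i~m = trans (sym (g-adj j m)) (trans (cong (λ z → adj G z (g m)) (sym gi≡gj)) (trans (g-adj i m) i~m))

      g-neighbours : ∀ i {s} → g i ~ s → s ≡ g (prev i) ⊎ s ≡ g (next i)
      g-neighbours i = only-two-neighbours k≡2 (c5-prev≢next i ∘ g-injective)
        (∈-intro (trans (g-adj i (prev i)) (c5-prev i))) (g-edge i)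

      g-closed : ∀ {s t} → Walk G s t → ∀ i → s ≡ g i → ∃ λ j → t ≡ g j
      g-closed nil i s≡gi = i , s≡gi
      g-closed (cons {v = r} s~r rest) i refl with g-neighbours i (∈-intro s~r)
      ... | inj₁ r≡ = g-closed rest (prev i) r≡
      ... | inj₂ r≡ = g-closed rest (next i) r≡

      g-surjective : ∀ s → ∃ λ i → s ≡ g i
      g-surjective s = g-closed (connected u s) v₀ refl

      isomorphic : Isomorphic G pentagon
      isomorphic = mk⤖ {to = f} (f-injective , f-surjective) , λ s s′ →
          trans (cong₂ (adj G) (proj₂ (g-surjective s)) (proj₂ (g-surjective s′))) (g-adj (f s) (f s′))
        where
        f : Fin n → Fin 5
        f s = proj₁ (g-surjective s)
        f-injective : ∀ {s s′} → f s ≡ f s′ → s ≡ s′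
        f-injective {s} {s′} e = trans (proj₂ (g-surjective s)) (trans (cong g e) (sym (proj₂ (g-surjective s′))))
        f-surjective : ∀ i → ∃ λ s → ∀ {s′} → s′ ≡ s → f s′ ≡ i
        f-surjective i = g i , λ { refl → g-injective (sym (proj₂ (g-surjective (g i)))) }

2a+5-via-μ≥2 : ∀ {a k c} → 2 * a + 3 ≤ k + c → 2 ≤ c → 2 * a + 5 ≤ k + 2 * c
2a+5-via-μ≥2 {a} {k} {c} cherry 2≤c = begin
  2 * a + 5       ≡⟨ identity₁ a ⟩
  2 * a + 3 + 2   ≤⟨ +-mono-≤ cherry 2≤c ⟩
  k + c + c       ≡⟨ identity₂ k c ⟩
  k + 2 * c       ∎
  where
  open ≤-Reasoning
  identity₁ : ∀ a → 2 * a + 5 ≡ 2 * a + 3 + 2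
  identity₁ = solve-∀
  identity₂ : ∀ k c → k + c + c ≡ k + 2 * c
  identity₂ = solve-∀

2a+5-via-claw : ∀ {a k} → 3 * suc a ≤ k → 2 * a + 5 ≤ k + 2 * 1
2a+5-via-claw {a} {k} claw = begin
  2 * a + 5         ≤⟨ m≤n+m _ a ⟩
  a + (2 * a + 5)   ≡⟨ identity a ⟩
  3 * suc a + 2     ≤⟨ +-monoˡ-≤ 2 claw ⟩
  k + 2             ∎
  where
  open ≤-Reasoning
  identity : ∀ a → a + (2 * a + 5) ≡ 3 * suc a + 2
  identity = solve-∀

2a+5-via-k≥3 : ∀ {a k} → a ≡ 0 → 3 ≤ k → 2 * a + 5 ≤ k + 2 * 1
2a+5-via-k≥3 refl 3≤k = +-monoˡ-≤ 2 3≤k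

a+2≤k-via-μ≡1 : ∀ {a k} → 2 * a + 3 ≤ k + 1 → a + 2 ≤ k
a+2≤k-via-μ≡1 {a} {k} cherry = begin
  a + 2             ≤⟨ +-monoˡ-≤ 2 (m≤m+n a (a + 0)) ⟩
  2 * a + 2         ≤⟨ ≤-pred (subst₂ _≤_ (identity a) (+-comm k 1) cherry) ⟩
  k                 ∎
  where
  open ≤-Reasoning
  identity : ∀ a → 2 * a + 3 ≡ suc (2 * a + 2)
  identity = solve-∀

mainTheorem8 : (n k a c : ℕ) (G : Graph n) →
    IsSRG G k a c → Connected G → ¬ IsComplete G → ¬ Isomorphic G pentagon →
    2 * a + 5 ≤ k + 2 * c
mainTheorem8 n k a c G srg connected incomplete not-pentagon =
  case m≤n⇒m<n∨m≡n (μ-positive cherry) of λ where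
    (inj₁ 2≤c) → 2a+5-via-μ≥2 {a} (cherry-bound cherry) 2≤c
    (inj₂ 1≡c) → subst (λ μ → 2 * a + 5 ≤ k + 2 * μ) 1≡c (μ≡1-case (sym 1≡c))
  where
  open SRG G k a c srg
  cherry : Cherry
  cherry = cherry-exists connected incomplete

  a+2≤k : c ≡ 1 → a + 2 ≤ k
  a+2≤k μ≡1 = a+2≤k-via-μ≡1 (subst (λ μ → 2 * a + 3 ≤ k + μ) μ≡1 (cherry-bound cherry))

  μ≡1-case : c ≡ 1 → 2 * a + 5 ≤ k + 2 * 1
  μ≡1-case μ≡1 with a ≟ℕ 0 | k ≟ℕ 2
  ... | no a≢0  | _       = 2a+5-via-claw {a} (claw-bound (proj₂ (claw-exists (n≢0⇒n>0 a≢0) (a+2≤k μ≡1) cherry)))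
    where open UniqueCommonNeighbour μ≡1
  ... | yes a≡0 | yes k≡2 = ⊥-elim (not-pentagon (Pentagon.isomorphic a≡0 k≡2 connected u~v v~w u-w))
    where open UniqueCommonNeighbour μ≡1
          open Cherry cherry
  ... | yes a≡0 | no k≢2  = 2a+5-via-k≥3 a≡0 (≤∧≢⇒< (subst (λ α → α + 2 ≤ k) a≡0 (a+2≤k μ≡1)) (k≢2 ∘ sym))
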